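{- $\mathrm{SYM}\circ\mathrm{MAJ}\subseteq k\mathrm{STAT}_{\mathrm{poly}}$.
   Context: All classes are classes of families of Boolean functions on $\{0,1\}^n$; "polynomial" means polynomial in $n$. A majority gate is a threshold gate $\mathbf{1}[\langle\mathbf{w},\mathbf{z}\rangle\ge\theta]$ with integer weights and threshold polynomially bounded in absolute value. $\mathrm{SYM}\circ\mathrm{MAJ}$ is the class of functions $f(\mathbf{x})=g(h_1(\mathbf{x}),\dots,h_s(\mathbf{x}))$ where $s$ is polynomial, each $h_i$ is a majority gate whose inputs are variables, negated variables, or constants, and $g:\{0,1\}^s\to\{0,1\}$ is symmetric (depends only on the Hamming weight of its input). For a vector $\mathbf{z}$, $\mathbf{z}_{(k)}$ denotes its $k$-th smallest entry. $k\mathrm{STAT}_{\mathrm{poly}}$ is the class of functions $f$ for which there exist linear forms (affine functions) $L_1,\dots,L_{\ell_1},R_1,\dots,R_{\ell_2}$ with integer coefficients bounded in absolute value by a polynomial in $n$, $\ell_1+\ell_2$ polynomial in $n$, and integers $k_l,k_r$, such that $f(\mathbf{x})=1\iff(L_1(\mathbf{x}),\dots,L_{\ell_1}(\mathbf{x}))_{(k_l)}<(R_1(\mathbf{x}),\dots,R_{\ell_2}(\mathbf{x}))_{(k_r)}$. -}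

module Defs where

open import Data.Bool using (Bool; true; false; if_then_else_)
open import Data.Nat as ℕ using (ℕ; zero; suc; _^_)
open import Data.Integer as ℤ using (ℤ; +_; ∣_∣)
open import Data.Integer.Properties using (≤-decTotalOrder)
open import Data.Fin using (Fin)
open import Data.Vec using (Vec; lookup; count)
open import Data.List using (List; []; _∷_; length; map; foldr)
open import Data.List.Relation.Unary.All using (All)
open import Data.Product using (_×_; Σ; ∃; ∃-syntax; _,_)
open import Relation.Binary.PropositionalEquality using (_≡_)
open import Relation.Nullary.Decidable using (does)
import Data.List.Sort as Sorting
open Sorting ≤-decTotalOrder using (sort)
open import Function.Bundles using (_⇔_)
import Data.Vec
import Data.Vec.Relation.Unary.All as VAll
import Data.Bool
import Data.Bool.Properties

BoolFun : ℕ → Set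
BoolFun n = Vec Bool n → Bool

Family : Set
Family = (n : ℕ) → BoolFun n

-- The polynomial bound n^c + c (any polynomial in n is dominated by one of these).
poly : ℕ → ℕ → ℕ
poly c n = n ^ c ℕ.+ c

bit : Bool → ℤ
bit b = if b then + 1 else + 0

data Literal (n : ℕ) : Set where
  var    : Fin n → Literal n
  negvar : Fin n → Literal n
  const  : Bool → Literal n

evalLit : ∀ {n} → Literal n → Vec Bool n → Bool
evalLit (var i)    x = lookup x i
evalLit (negvar i) x = Data.Bool.not (lookup x i)
evalLit (const b)  x = b

record MajGate (n : ℕ) : Set where
  constructor majGate
  field
    inputs    : List (Literal n × ℤ)
    threshold : ℤ
open MajGate public

evalMaj : ∀ {n} → MajGate n → Vec Bool n → Bool
evalMaj g x =
  does (threshold g ℤ.≤? foldr ℤ._+_ (+ 0) (map (λ { (l , w) → w ℤ.* bit (evalLit l x) }) (inputs g)))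

MajBounded : ∀ {n} → ℕ → MajGate n → Set
MajBounded B g =
  (length (inputs g) ℕ.≤ B) ×
  (All (λ { (l , w) → ∣ w ∣ ℕ.≤ B }) (inputs g)) ×
  (∣ threshold g ∣ ℕ.≤ B)

Symmetric : ∀ {s} → (Vec Bool s → Bool) → Set
Symmetric {s} g = ∀ (u v : Vec Bool s) →
  count (λ b → Data.Bool.Properties.T? b) u ≡ count (λ b → Data.Bool.Properties.T? b) v → g u ≡ g v

SYM∘MAJ : Family → Set
SYM∘MAJ f = ∃[ c ] ∀ n → ∃[ s ] Σ (Vec (MajGate n) s) λ hs → Σ (Vec Bool s → Bool) λ g →
  (s ℕ.≤ poly c n) ×
  VAll.All (MajBounded (poly c n)) hs ×
  Symmetric g ×
  (∀ (x : Vec Bool n) → f n x ≡ g (Data.Vec.map (λ h → evalMaj h x) hs))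

record Affine (n : ℕ) : Set where
  constructor affine
  field
    constTerm : ℤ
    coeffs    : Vec ℤ n
open Affine public

evalAffine : ∀ {n} → Affine n → Vec Bool n → ℤ
evalAffine {n} L x =
  constTerm L ℤ.+ Data.Vec.foldr (λ _ → ℤ) ℤ._+_ (+ 0)
    (Data.Vec.zipWith (λ a b → a ℤ.* bit b) (coeffs L) x)

AffineBounded : ∀ {n} → ℕ → Affine n → Set
AffineBounded B L =
  (∣ constTerm L ∣ ℕ.≤ B) × VAll.All (λ a → ∣ a ∣ ℕ.≤ B) (coeffs L)

-- k-th smallest entry (k is 1-based) of a list of integers; returns 0
-- when k is out of range (only used with 1 ≤ k ≤ length).
nth : List ℤ → ℕ → ℤ
nth []       _       = + 0
nth (z ∷ zs) zero    = z
nth (z ∷ zs) (suc k) = nth zs k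

kthSmallest : ℕ → List ℤ → ℤ
kthSmallest k zs = nth (sort zs) (k ℕ.∸ 1)

kSTAT : Family → Set
kSTAT f = ∃[ c ] ∀ n → ∃[ ℓ₁ ] ∃[ ℓ₂ ]
  Σ (Vec (Affine n) ℓ₁) λ Ls → Σ (Vec (Affine n) ℓ₂) λ Rs → ∃[ kₗ ] ∃[ kᵣ ]
  (ℓ₁ ℕ.+ ℓ₂ ℕ.≤ poly c n) ×
  VAll.All (AffineBounded (poly c n)) Ls ×
  VAll.All (AffineBounded (poly c n)) Rs ×
  (1 ℕ.≤ kₗ) × (kₗ ℕ.≤ ℓ₁) × (1 ℕ.≤ kᵣ) × (kᵣ ℕ.≤ ℓ₂) ×
  (∀ (x : Vec Bool n) →
     (f n x ≡ true) ⇔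
     (kthSmallest kₗ (Data.Vec.toList (Data.Vec.map (λ L → evalAffine L x) Ls))
        ℤ.< kthSmallest kᵣ (Data.Vec.toList (Data.Vec.map (λ R → evalAffine R x) Rs))))

-- A majority gate h with weighted input sum Σ and threshold θ becomes the affine form −(q+1)(Σ − θ),
-- which is ≤ 0 when h fires and > q when it does not.  Append to the s gate forms constants
-- a₀ ≤ a₁ ≤ … ≤ a_s lying in (0, q]: if t gates fire, the t gate values below the gap are followed by
-- a₀, a₁, …, so the (s+1)-th smallest entry is a_{s−t}.  Take a_j = 2j+2 on the left, and on the right
-- a_j = 2j+3 or 2j+1 according to whether g accepts inputs of Hamming weight s−j.  Both sequences are
-- monotone, and the left statistic is below the right one exactly when g accepts weight t, i.e. when the
-- circuit outputs 1.  With q = 2s+3 every coefficient is O(B³) for the circuit's size and weight bound B.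

module Submission where

open import Data.Bool using (Bool; true; false; not; if_then_else_)
open import Data.Bool.Properties using (T?)
open import Data.Nat as ℕ using (ℕ; zero; suc; z≤n; s≤s)
import Data.Nat.Properties as ℕP
open import Data.Integer as ℤ using (ℤ; +_; -[1+_]; ∣_∣)
open import Data.Integer.Tactic.RingSolver using (solve-∀)
open import Data.Nat.Tactic.RingSolver using () renaming (solve-∀ to solve-∀ℕ)
open import Data.Fin using (Fin; zero; suc)
import Data.Integer.Properties as ℤP
open import Data.List using (List; []; _∷_; _++_; length; filter; foldr)
import Data.List as List
open import Data.List.Properties using (length-++; filter-++; filter-none)
open import Data.List.Relation.Unary.All as All using (All; []; _∷_)
open import Data.List.Relation.Unary.AllPairs using (AllPairs; []; _∷_)
open import Data.List.Relation.Unary.Linked.Properties using (Linked⇒AllPairs)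
open import Data.List.Relation.Binary.Permutation.Propositional using (_↭_)
open import Data.List.Relation.Binary.Permutation.Propositional.Properties using (↭-length; filter-↭)
open import Data.List.Sort ℤP.≤-decTotalOrder using (sort; sort-↭; sort-↗)
open import Data.Vec as V using (Vec; []; _∷_; toList; lookup; _[_]≔_)
import Data.Vec.Relation.Unary.All as VAll
open VAll using ([]; _∷_)
import Data.Vec.Relation.Unary.All.Properties as VAllP
import Data.Vec.Properties as VP
open import Data.Product using (_×_; _,_; proj₁; proj₂; ∃-syntax; Σ)
open import Data.Sum using (inj₁; inj₂)
open import Function using (_∘_)
open import Function.Bundles using (_⇔_; mk⇔)
open import Relation.Binary.Core using (_Preserves_⟶_)
open import Relation.Binary.PropositionalEquality
open import Relation.Nullary using (yes; no; contradiction)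
open import Relation.Nullary.Decidable using (does)
open import Relation.Unary using (Pred; Decidable)

open import Defs

module _ {a p} {A : Set a} {P : Pred A p} (P? : Decidable P) where

  length-filter-++ : ∀ xs ys →
    length (filter P? (xs ++ ys)) ≡ length (filter P? xs) ℕ.+ length (filter P? ys)
  length-filter-++ xs ys = trans (cong length (filter-++ P? xs ys)) (length-++ (filter P? xs))

  length-filter-↭ : ∀ {xs ys} → xs ↭ ys → length (filter P? xs) ≡ length (filter P? ys)
  length-filter-↭ = ↭-length ∘ filter-↭ P?

below atMost : ℤ → List ℤ → ℕ
below  v zs = length (filter (ℤ._<? v) zs)
atMost v zs = length (filter (ℤ._≤? v) zs)

below-none : ∀ {v zs} → All (v ℤ.≤_) zs → below v zs ≡ 0
below-none v≤zs = cong length (filter-none (ℤ._<? _) (All.map ℤP.≤⇒≯ v≤zs))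

atMost-none : ∀ {v zs} → All (v ℤ.<_) zs → atMost v zs ≡ 0
atMost-none v<zs = cong length (filter-none (ℤ._≤? _) (All.map ℤP.<⇒≱ v<zs))

nth-sorted : ∀ {v} zs k → AllPairs ℤ._≤_ zs →
  below v zs ℕ.≤ k → k ℕ.< atMost v zs → nth zs k ≡ v
nth-sorted {v} (z ∷ zs) k (z≤zs ∷ sorted) lo hi with z ℤ.<? v | z ℤ.≤? v
... | yes z<v | no z≰v = contradiction (ℤP.<⇒≤ z<v) z≰v
nth-sorted (z ∷ zs) (suc k) (_ ∷ sorted) (s≤s lo) (s≤s hi) | yes _ | yes _ =
  nth-sorted zs k sorted lo hi
nth-sorted (z ∷ zs) zero    _ _ _ | no z≮v | yes z≤v = ℤP.≤-antisym z≤v (ℤP.≮⇒≥ z≮v)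
nth-sorted (z ∷ zs) (suc k) (z≤zs ∷ sorted) _ (s≤s hi) | no z≮v | yes _ =
  nth-sorted zs k sorted
    (subst (ℕ._≤ k) (sym (below-none (All.map (ℤP.≤-trans (ℤP.≮⇒≥ z≮v)) z≤zs))) z≤n) hi
... | no _ | no z≰v =
  contradiction (subst (k ℕ.<_) (atMost-none (All.map (ℤP.<-≤-trans (ℤP.≰⇒> z≰v)) z≤zs)) hi)
                ℕP.n≮0

nth-sort : ∀ {v} ys k → below v ys ℕ.≤ k → k ℕ.< atMost v ys → nth (sort ys) k ≡ v
nth-sort ys k lo hi = nth-sorted (sort ys) k (Linked⇒AllPairs ℤP.≤-trans (sort-↗ ys))
  (subst (ℕ._≤ k) (sym (length-filter-↭ (ℤ._<? _) (sort-↭ ys))) lo)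
  (subst (k ℕ.<_) (sym (length-filter-↭ (ℤ._≤? _) (sort-↭ ys))) hi)

stairs : (m : ℕ) → (ℕ → ℤ) → Vec ℤ m
stairs zero    φ = []
stairs (suc m) φ = φ 0 ∷ stairs m (φ ∘ suc)

stairs-lowerBound : ∀ m {v} φ → (∀ j → v ℤ.≤ φ j) → All (v ℤ.≤_) (toList (stairs m φ))
stairs-lowerBound zero    φ v≤φ = []
stairs-lowerBound (suc m) φ v≤φ = v≤φ 0 ∷ stairs-lowerBound m (φ ∘ suc) (v≤φ ∘ suc)

stairs-rank : ∀ m φ → φ Preserves ℕ._≤_ ⟶ ℤ._≤_ → ∀ {j} → j ℕ.< m →
  below (φ j) (toList (stairs m φ)) ℕ.≤ j × j ℕ.< atMost (φ j) (toList (stairs m φ))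
stairs-rank (suc m) φ mono {zero} _ with φ 0 ℤ.<? φ 0 | φ 0 ℤ.≤? φ 0
... | no _        | yes _     =
  ℕP.≤-reflexive (below-none (stairs-lowerBound m (φ ∘ suc) (λ _ → mono z≤n))) , s≤s z≤n
... | yes φ0<φ0   | _         = contradiction φ0<φ0 (ℤP.<-irrefl refl)
... | no _        | no φ0≰φ0  = contradiction ℤP.≤-refl φ0≰φ0
stairs-rank (suc m) φ mono {suc j} (s≤s j<m)
  with stairs-rank m (φ ∘ suc) (mono ∘ s≤s) j<m | φ 0 ℤ.<? φ (suc j) | φ 0 ℤ.≤? φ (suc j)
... | lo , hi | yes _ | yes _ = s≤s lo , s≤s hi
... | lo , hi | no _  | yes _ = ℕP.m≤n⇒m≤1+n lo , s≤s hi
... | _       | _     | no φ0≰ = contradiction (mono z≤n) φ0≰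

module _ {n : ℕ} where

  -- evalAffine (affine a cs) x is definitionally a ℤ.+ dot cs x.
  dot : Vec ℤ n → Vec Bool n → ℤ
  dot cs x = V.foldr (λ _ → ℤ) ℤ._+_ (+ 0) (V.zipWith (λ a b → a ℤ.* bit b) cs x)

  zeros : Vec ℤ n
  zeros = V.replicate n (+ 0)

  constᴬ : ℤ → Affine n
  constᴬ a = affine a zeros

  infixl 6 _+ᴬ_
  infixl 7 _·ᴬ_

  _+ᴬ_ : Affine n → Affine n → Affine n
  affine a cs +ᴬ affine b ds = affine (a ℤ.+ b) (V.zipWith ℤ._+_ cs ds)

  _·ᴬ_ : ℤ → Affine n → Affine n
  q ·ᴬ affine a cs = affine (q ℤ.* a) (V.map (q ℤ.*_) cs)

  literalᴬ : Literal n → ℤ → Affine n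
  literalᴬ (var i)    w = affine (+ 0) (zeros [ i ]≔ w)
  literalᴬ (negvar i) w = affine w (zeros [ i ]≔ ℤ.- w)
  literalᴬ (const b)  w = constᴬ (w ℤ.* bit b)

  sumᴬ : List (Literal n × ℤ) → Affine n
  sumᴬ []             = constᴬ (+ 0)
  sumᴬ ((l , w) ∷ ps) = literalᴬ l w +ᴬ sumᴬ ps

dot-zeros : ∀ {n} (x : Vec Bool n) → dot zeros x ≡ + 0
dot-zeros []      = refl
dot-zeros (b ∷ x) = cong (ℤ._+_ (+ 0 ℤ.* bit b)) (dot-zeros x)

dot-single : ∀ {n} (i : Fin n) w (x : Vec Bool n) → dot (zeros [ i ]≔ w) x ≡ w ℤ.* bit (lookup x i)
dot-single zero    w (b ∷ x) = trans (cong (ℤ._+_ (w ℤ.* bit b)) (dot-zeros x)) (ℤP.+-identityʳ _)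
dot-single (suc i) w (b ∷ x) = trans (cong (ℤ._+_ (+ 0)) (dot-single i w x)) (ℤP.+-identityˡ _)

dot-+ : ∀ {n} (cs ds : Vec ℤ n) x → dot (V.zipWith ℤ._+_ cs ds) x ≡ dot cs x ℤ.+ dot ds x
dot-+ []       []       []      = refl
dot-+ (c ∷ cs) (d ∷ ds) (b ∷ x) rewrite dot-+ cs ds x = distrib c d (bit b) (dot cs x) (dot ds x)
  where
  distrib : ∀ c d y u v → (c ℤ.+ d) ℤ.* y ℤ.+ (u ℤ.+ v) ≡ (c ℤ.* y ℤ.+ u) ℤ.+ (d ℤ.* y ℤ.+ v)
  distrib = solve-∀

dot-* : ∀ {n} q (cs : Vec ℤ n) x → dot (V.map (q ℤ.*_) cs) x ≡ q ℤ.* dot cs x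
dot-* q []       []      = sym (ℤP.*-zeroʳ q)
dot-* q (c ∷ cs) (b ∷ x) rewrite dot-* q cs x = distrib q c (bit b) (dot cs x)
  where
  distrib : ∀ q c y u → q ℤ.* c ℤ.* y ℤ.+ q ℤ.* u ≡ q ℤ.* (c ℤ.* y ℤ.+ u)
  distrib = solve-∀

evalAffine-const : ∀ {n} a (x : Vec Bool n) → evalAffine (constᴬ a) x ≡ a
evalAffine-const a x = trans (cong (ℤ._+_ a) (dot-zeros x)) (ℤP.+-identityʳ a)

evalAffine-+ : ∀ {n} (A B : Affine n) x → evalAffine (A +ᴬ B) x ≡ evalAffine A x ℤ.+ evalAffine B x
evalAffine-+ (affine a cs) (affine b ds) x rewrite dot-+ cs ds x = interchange a b (dot cs x) (dot ds x)
  where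
  interchange : ∀ a b u v → a ℤ.+ b ℤ.+ (u ℤ.+ v) ≡ a ℤ.+ u ℤ.+ (b ℤ.+ v)
  interchange = solve-∀

evalAffine-· : ∀ {n} q (A : Affine n) x → evalAffine (q ·ᴬ A) x ≡ q ℤ.* evalAffine A x
evalAffine-· q (affine a cs) x rewrite dot-* q cs x = sym (ℤP.*-distribˡ-+ q a (dot cs x))

weighted-bit-not : ∀ w b → w ℤ.+ ℤ.- w ℤ.* bit b ≡ w ℤ.* bit (not b)
weighted-bit-not w true  = identity w
  where
  identity : ∀ w → w ℤ.+ ℤ.- w ℤ.* + 1 ≡ w ℤ.* + 0
  identity = solve-∀
weighted-bit-not w false = identity w
  where
  identity : ∀ w → w ℤ.+ ℤ.- w ℤ.* + 0 ≡ w ℤ.* + 1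
  identity = solve-∀

evalAffine-literal : ∀ {n} (l : Literal n) w x → evalAffine (literalᴬ l w) x ≡ w ℤ.* bit (evalLit l x)
evalAffine-literal (var i)    w x = trans (cong (ℤ._+_ (+ 0)) (dot-single i w x)) (ℤP.+-identityˡ _)
evalAffine-literal (negvar i) w x =
  trans (cong (ℤ._+_ w) (dot-single i (ℤ.- w) x)) (weighted-bit-not w (lookup x i))
evalAffine-literal (const b)  w x = evalAffine-const _ x

-- The sum inside evalMaj: evalMaj h x is definitionally does (threshold h ℤ.≤? weightedSum x (inputs h)).
weightedSum : ∀ {n} → Vec Bool n → List (Literal n × ℤ) → ℤ
weightedSum x = foldr ℤ._+_ (+ 0) ∘ List.map (λ p → proj₂ p ℤ.* bit (evalLit (proj₁ p) x))

evalAffine-sum : ∀ {n} ps (x : Vec Bool n) → evalAffine (sumᴬ ps) x ≡ weightedSum x ps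
evalAffine-sum []             x = evalAffine-const _ x
evalAffine-sum ((l , w) ∷ ps) x =
  trans (evalAffine-+ (literalᴬ l w) (sumᴬ ps) x)
        (cong₂ ℤ._+_ (evalAffine-literal l w x) (evalAffine-sum ps x))

AbsBounded : ℕ → ℤ → Set
AbsBounded B c = ∣ c ∣ ℕ.≤ B

zeros-bounded : ∀ {n} B → VAll.All (AbsBounded B) (zeros {n})
zeros-bounded {zero}  B = []
zeros-bounded {suc n} B = z≤n ∷ zeros-bounded B

single-bounded : ∀ {n} (i : Fin n) w → VAll.All (AbsBounded ∣ w ∣) (zeros [ i ]≔ w)
single-bounded zero    w = ℕP.≤-refl ∷ zeros-bounded ∣ w ∣
single-bounded (suc i) w = z≤n ∷ single-bounded i w

module _ {n : ℕ} where

  AffineBounded-mono : ∀ {a b} (A : Affine n) → a ℕ.≤ b → AffineBounded a A → AffineBounded b A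
  AffineBounded-mono _ a≤b (c≤a , cs≤a) =
    ℕP.≤-trans c≤a a≤b , VAll.map (λ c≤a → ℕP.≤-trans c≤a a≤b) cs≤a

  AffineBounded-const : ∀ a → AffineBounded ∣ a ∣ (constᴬ {n} a)
  AffineBounded-const a = ℕP.≤-refl , zeros-bounded ∣ a ∣

  AffineBounded-+ : ∀ {a b} (A B : Affine n) → AffineBounded a A → AffineBounded b B →
    AffineBounded (a ℕ.+ b) (A +ᴬ B)
  AffineBounded-+ (affine c cs) (affine d ds) (c≤a , cs≤a) (d≤b , ds≤b) =
    +-bounded c d c≤a d≤b , VAll.zipWith (λ {x} {y} → +-bounded x y) cs≤a ds≤b
    where
    +-bounded : ∀ {a b} x y → AbsBounded a x → AbsBounded b y → AbsBounded (a ℕ.+ b) (x ℤ.+ y)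
    +-bounded x y x≤a y≤b = ℕP.≤-trans (ℤP.∣i+j∣≤∣i∣+∣j∣ x y) (ℕP.+-mono-≤ x≤a y≤b)

  AffineBounded-· : ∀ {a} q (A : Affine n) → AffineBounded a A →
    AffineBounded (∣ q ∣ ℕ.* a) (q ·ᴬ A)
  AffineBounded-· q (affine c cs) (c≤a , cs≤a) =
    *-bounded c c≤a , VAllP.map⁺ (VAll.map (λ {x} → *-bounded x) cs≤a)
    where
    *-bounded : ∀ {a} x → AbsBounded a x → AbsBounded (∣ q ∣ ℕ.* a) (q ℤ.* x)
    *-bounded x x≤a = ℕP.≤-trans (ℕP.≤-reflexive (ℤP.abs-* q x)) (ℕP.*-monoʳ-≤ ∣ q ∣ x≤a)

  AffineBounded-literal : ∀ (l : Literal n) w → AffineBounded ∣ w ∣ (literalᴬ l w)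
  AffineBounded-literal (var i)    w = z≤n , single-bounded i w
  AffineBounded-literal (negvar i) w =
    ℕP.≤-refl , subst (λ b → VAll.All (AbsBounded b) (zeros [ i ]≔ ℤ.- w)) (ℤP.∣-i∣≡∣i∣ w)
                      (single-bounded i (ℤ.- w))
  AffineBounded-literal (const b)  w =
    AffineBounded-mono (constᴬ (w ℤ.* bit b)) (∣w*b∣≤∣w∣ b) (AffineBounded-const (w ℤ.* bit b))
    where
    ∣w*b∣≤∣w∣ : ∀ b → ∣ w ℤ.* bit b ∣ ℕ.≤ ∣ w ∣
    ∣w*b∣≤∣w∣ true  = ℕP.≤-reflexive (cong ∣_∣ (ℤP.*-identityʳ w))
    ∣w*b∣≤∣w∣ false = ℕP.≤-trans (ℕP.≤-reflexive (cong ∣_∣ (ℤP.*-zeroʳ w))) z≤n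

  AffineBounded-sum : ∀ {B} ps → All (λ p → ∣ proj₂ p ∣ ℕ.≤ B) ps →
    AffineBounded (length ps ℕ.* B) (sumᴬ ps)
  AffineBounded-sum []             []          = AffineBounded-const (+ 0)
  AffineBounded-sum ((l , w) ∷ ps) (w≤B ∷ ps≤B) =
    AffineBounded-+ (literalᴬ l w) (sumᴬ ps)
      (AffineBounded-mono (literalᴬ l w) w≤B (AffineBounded-literal l w)) (AffineBounded-sum ps ps≤B)

module _ {n : ℕ} where

  marginᴬ : MajGate n → Affine n
  marginᴬ h = sumᴬ (inputs h) +ᴬ constᴬ (ℤ.- threshold h)

  gateᴬ : ℕ → MajGate n → Affine n
  gateᴬ q h = -[1+ q ] ·ᴬ marginᴬ h

  evalAffine-gate : ∀ q h x →
    evalAffine (gateᴬ q h) x ≡ -[1+ q ] ℤ.* (weightedSum x (inputs h) ℤ.- threshold h)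
  evalAffine-gate q h x = trans (evalAffine-· -[1+ q ] (marginᴬ h) x) (cong (-[1+ q ] ℤ.*_)
    (trans (evalAffine-+ (sumᴬ (inputs h)) (constᴬ _) x)
           (cong₂ ℤ._+_ (evalAffine-sum (inputs h) x) (evalAffine-const _ x))))

  AffineBounded-gate : ∀ {B} q (h : MajGate n) → MajBounded B h →
    AffineBounded (suc q ℕ.* (B ℕ.* B ℕ.+ B)) (gateᴬ q h)
  AffineBounded-gate {B} q h@(majGate ps θ) (fanIn≤B , ps≤B , ∣θ∣≤B) =
    AffineBounded-· -[1+ q ] (marginᴬ h) (AffineBounded-mono (marginᴬ h) margin≤
      (AffineBounded-+ (sumᴬ ps) (constᴬ (ℤ.- θ)) (AffineBounded-sum ps ps≤B) (AffineBounded-const (ℤ.- θ))))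
    where
    margin≤ : length ps ℕ.* B ℕ.+ ∣ ℤ.- θ ∣ ℕ.≤ B ℕ.* B ℕ.+ B
    margin≤ = ℕP.+-mono-≤ (ℕP.*-monoˡ-≤ B fanIn≤B) (ℕP.≤-trans (ℕP.≤-reflexive (ℤP.∣-i∣≡∣i∣ θ)) ∣θ∣≤B)

Encodes : ℕ → Bool → ℤ → Set
Encodes q true  u = u ℤ.≤ + 0
Encodes q false u = + q ℤ.< u

scaledMargin-encodes : ∀ q θ Σ → Encodes q (does (θ ℤ.≤? Σ)) (-[1+ q ] ℤ.* (Σ ℤ.- θ))
scaledMargin-encodes q θ Σ with θ ℤ.≤? Σ
... | yes θ≤Σ = ℤP.≤-trans (ℤP.*-monoˡ-≤-nonPos -[1+ q ] (ℤP.i≤j⇒0≤j-i θ≤Σ))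
                           (ℤP.≤-reflexive (ℤP.*-zeroʳ -[1+ q ]))
... | no θ≰Σ = negative (ℤP.≰⇒> (θ≰Σ ∘ ℤP.0≤i-j⇒j≤i))
  where
  negative : ∀ {d} → d ℤ.< + 0 → + q ℤ.< -[1+ q ] ℤ.* d
  negative { -[1+ m ]} _         = ℤ.+<+ (ℕP.m≤m*n (suc q) (suc m))
  negative { + _ }     (ℤ.+<+ ())

module _ {n : ℕ} where

  gate-encodes : ∀ q (h : MajGate n) x → Encodes q (evalMaj h x) (evalAffine (gateᴬ q h) x)
  gate-encodes q h x = subst (Encodes q (evalMaj h x)) (sym (evalAffine-gate q h x))
    (scaledMargin-encodes q (threshold h) (weightedSum x (inputs h)))

  gateValues : ∀ {s} → ℕ → Vec (MajGate n) s → Vec Bool n → List ℤ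
  gateValues q hs x = toList (V.map (λ h → evalAffine (gateᴬ q h) x) hs)

  firing : ∀ {s} → Vec (MajGate n) s → Vec Bool n → ℕ
  firing hs x = V.count T? (V.map (λ h → evalMaj h x) hs)

  firing≤length : ∀ {s} (hs : Vec (MajGate n) s) x → firing hs x ℕ.≤ s
  firing≤length hs x = VP.count≤n T? (V.map (λ h → evalMaj h x) hs)

  gateValues-rank : ∀ q {s} (hs : Vec (MajGate n) s) x {v} → + 0 ℤ.< v → v ℤ.≤ + q →
    below v (gateValues q hs x) ≡ firing hs x × atMost v (gateValues q hs x) ≡ firing hs x
  gateValues-rank q [] x _ _ = refl , refl
  gateValues-rank q (h ∷ hs) x {v} 0<v v≤q
    with gateValues-rank q hs x 0<v v≤q | evalMaj h x | gate-encodes q h x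
       | evalAffine (gateᴬ q h) x ℤ.<? v | evalAffine (gateᴬ q h) x ℤ.≤? v
  ... | ih₁ , ih₂ | true  | _ | yes _ | yes _ = cong suc ih₁ , cong suc ih₂
  ... | ih₁ , ih₂ | false | _ | no _  | no _  = ih₁ , ih₂
  ... | _ | true  | u≤0 | no u≮v | _       = contradiction (ℤP.≤-<-trans u≤0 0<v) u≮v
  ... | _ | true  | u≤0 | _      | no u≰v  = contradiction (ℤP.≤-trans u≤0 (ℤP.<⇒≤ 0<v)) u≰v
  ... | _ | false | q<u | yes u<v | _      = contradiction (ℤP.≤-<-trans v≤q q<u) (ℤP.<-asym u<v)
  ... | _ | false | q<u | _      | yes u≤v = contradiction u≤v (ℤP.<⇒≱ (ℤP.≤-<-trans v≤q q<u))

nth-sort-gates++stairs : ∀ q {n s} (hs : Vec (MajGate n) s) x m φ → φ Preserves ℕ._≤_ ⟶ ℤ._≤_ →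
  ∀ {j} → j ℕ.< m → + 0 ℤ.< φ j → φ j ℤ.≤ + q →
  nth (sort (gateValues q hs x ++ toList (stairs m φ))) (firing hs x ℕ.+ j) ≡ φ j
nth-sort-gates++stairs q hs x m φ mono {j} j<m 0<φj φj≤q = nth-sort (gates ++ steps) _ lo hi
  where
  open ℕP.≤-Reasoning
  gates = gateValues q hs x
  steps = toList (stairs m φ)
  gatesRank = gateValues-rank q hs x 0<φj φj≤q
  stepsRank = stairs-rank m φ mono j<m
  lo : below (φ j) (gates ++ steps) ℕ.≤ firing hs x ℕ.+ j
  lo = begin
    below (φ j) (gates ++ steps)          ≡⟨ length-filter-++ (ℤ._<? φ j) gates steps ⟩
    below (φ j) gates ℕ.+ below (φ j) steps ≡⟨ cong (ℕ._+ _) (proj₁ gatesRank) ⟩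
    firing hs x ℕ.+ below (φ j) steps     ≤⟨ ℕP.+-monoʳ-≤ (firing hs x) (proj₁ stepsRank) ⟩
    firing hs x ℕ.+ j                     ∎
  hi : firing hs x ℕ.+ j ℕ.< atMost (φ j) (gates ++ steps)
  hi = begin-strict
    firing hs x ℕ.+ j                        <⟨ ℕP.+-monoʳ-< (firing hs x) (proj₂ stepsRank) ⟩
    firing hs x ℕ.+ atMost (φ j) steps       ≡⟨ cong (ℕ._+ _) (proj₂ gatesRank) ⟨
    atMost (φ j) gates ℕ.+ atMost (φ j) steps ≡⟨ length-filter-++ (ℤ._≤? φ j) gates steps ⟨
    atMost (φ j) (gates ++ steps)            ∎

module _ where
  open import Data.Nat using (_+_; _*_; _^_; _≤_; _<_; >-nonZero)
  open ℕP.≤-Reasoning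

  +poly≤power : ∀ a c n → a + poly c n ≤ (2 + a + c + n) ^ suc c
  +poly≤power a c n = begin
    a + (n ^ c + c)          ≡⟨ shuffle a c (n ^ c) ⟩
    n ^ c + (a + c)          ≤⟨ ℕP.+-mono-≤ (ℕP.^-monoˡ-≤ c (ℕP.m≤n+m n (2 + a + c)))
                                            (ℕP.m≤m*n (a + c) (M ^ c) {{ℕP.m^n≢0 M c}}) ⟩
    suc (a + c) * M ^ c      ≤⟨ ℕP.*-monoˡ-≤ (M ^ c) 1+a+c≤M ⟩
    M ^ suc c                ∎
    where
    M = 2 + a + c + n
    1+a+c≤M = ℕP.≤-trans (ℕP.n≤1+n _) (ℕP.m≤m+n (2 + a + c) n)
    shuffle : ∀ a c m → a + (m + c) ≡ m + (a + c)
    shuffle = solve-∀ℕ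

  power≤poly : ∀ A K n → 2 ≤ A → (A + n) ^ K ≤ poly ((A + A) ^ K + K * 2) n
  power≤poly A K n 2≤A with n ℕP.<? A
  ... | yes n<A = begin
    (A + n) ^ K                              ≤⟨ ℕP.^-monoˡ-≤ K (ℕP.+-monoʳ-≤ A (ℕP.<⇒≤ n<A)) ⟩
    (A + A) ^ K                              ≤⟨ ℕP.m≤m+n _ _ ⟩
    (A + A) ^ K + K * 2                      ≤⟨ ℕP.m≤n+m _ (n ^ ((A + A) ^ K + K * 2)) ⟩
    poly ((A + A) ^ K + K * 2) n             ∎
  ... | no n≮A = begin
    (A + n) ^ K                              ≤⟨ ℕP.^-monoˡ-≤ K (ℕP.+-monoˡ-≤ n A≤n) ⟩
    (n + n) ^ K                              ≤⟨ ℕP.^-monoˡ-≤ K n+n≤n*n ⟩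
    (n * n) ^ K                              ≡⟨ cong (_^ K) (cong (n *_) (sym (ℕP.*-identityʳ n))) ⟩
    (n ^ 2) ^ K                              ≡⟨ ℕP.^-*-assoc n 2 K ⟩
    n ^ (2 * K)                              ≡⟨ cong (n ^_) (ℕP.*-comm 2 K) ⟩
    n ^ (K * 2)                              ≤⟨ ℕP.^-monoʳ-≤ n {{n≢0}} (ℕP.m≤n+m (K * 2) ((A + A) ^ K)) ⟩
    n ^ ((A + A) ^ K + K * 2)                ≤⟨ ℕP.m≤m+n _ _ ⟩
    poly ((A + A) ^ K + K * 2) n             ∎
    where
    A≤n = ℕP.≮⇒≥ n≮A
    2≤n = ℕP.≤-trans 2≤A A≤n
    n≢0 = >-nonZero (ℕP.<-≤-trans (s≤s z≤n) 2≤n)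
    n+n≤n*n : n + n ≤ n * n
    n+n≤n*n = ℕP.≤-trans (ℕP.≤-reflexive (cong (_+_ n) (sym (ℕP.+-identityʳ n)))) (ℕP.*-monoˡ-≤ n 2≤n)

  poly-power-bound : ∀ a k c → ∃[ c′ ] ∀ n → (a + poly c n) ^ k ≤ poly c′ n
  poly-power-bound a k c = (A + A) ^ K + K * 2 , λ n → begin
    (a + poly c n) ^ k      ≤⟨ ℕP.^-monoˡ-≤ k (+poly≤power a c n) ⟩
    ((A + n) ^ suc c) ^ k   ≡⟨ ℕP.^-*-assoc (A + n) (suc c) k ⟩
    (A + n) ^ K             ≤⟨ power≤poly A K n (s≤s (s≤s z≤n)) ⟩
    poly ((A + A) ^ K + K * 2) n ∎
    where
    A = 2 + a + c
    K = suc c * k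

  square≤fourth : ∀ {a b} z → a ≤ z * z → b ≤ z * z → a * b ≤ z ^ 4
  square≤fourth z a≤z² b≤z² = ℕP.≤-trans (ℕP.*-mono-≤ a≤z² b≤z²) (ℕP.≤-reflexive (expand z))
    where
    expand : ∀ z → z * z * (z * z) ≡ z * (z * (z * (z * 1)))
    expand = solve-∀ℕ

  4+2s≤[4+P]² : ∀ {s P} → s ≤ P → 4 + (s + s) ≤ (4 + P) * (4 + P)
  4+2s≤[4+P]² {s} {P} s≤P = begin
    4 + (s + s)                          ≤⟨ ℕP.+-monoʳ-≤ 4 (ℕP.+-mono-≤ s≤P s≤P) ⟩
    4 + (P + P)                          ≤⟨ ℕP.m≤m+n _ _ ⟩
    4 + (P + P) + (12 + 6 * P + P * P)   ≡⟨ expand P ⟩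
    (4 + P) * (4 + P)                    ∎
    where
    expand : ∀ P → 4 + (P + P) + (12 + 6 * P + P * P) ≡ (4 + P) * (4 + P)
    expand = solve-∀ℕ

  P²+P≤[4+P]² : ∀ P → P * P + P ≤ (4 + P) * (4 + P)
  P²+P≤[4+P]² P = ℕP.≤-trans (ℕP.m≤m+n (P * P + P) (16 + 7 * P)) (ℕP.≤-reflexive (expand P))
    where
    expand : ∀ P → P * P + P + (16 + 7 * P) ≡ (4 + P) * (4 + P)
    expand = solve-∀ℕ

InOddWindow : (ℕ → ℤ) → Set
InOddWindow φ = ∀ j → + (1 ℕ.+ (j ℕ.+ j)) ℤ.≤ φ j × φ j ℤ.≤ + (3 ℕ.+ (j ℕ.+ j))

oddWindow-monotone : ∀ {φ} → InOddWindow φ → φ Preserves ℕ._≤_ ⟶ ℤ._≤_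
oddWindow-monotone window {i} {j} i≤j with ℕP.m≤n⇒m<n∨m≡n i≤j
... | inj₂ refl = ℤP.≤-refl
... | inj₁ i<j  = ℤP.≤-trans (proj₂ (window i)) (ℤP.≤-trans (ℤ.+≤+ 3+2i≤1+2j) (proj₁ (window j)))
  where
  3+2i≤1+2j : 3 ℕ.+ (i ℕ.+ i) ℕ.≤ 1 ℕ.+ (j ℕ.+ j)
  3+2i≤1+2j = s≤s (ℕP.≤-trans (ℕP.≤-reflexive (cong suc (sym (ℕP.+-suc i i)))) (ℕP.+-mono-≤ i<j i<j))

stairs⁺ : ∀ {p} {P : Pred ℤ p} m φ → (∀ {j} → j ℕ.< m → P (φ j)) → VAll.All P (stairs m φ)
stairs⁺ zero    φ Pφ = []
stairs⁺ (suc m) φ Pφ = Pφ (s≤s z≤n) ∷ stairs⁺ m (φ ∘ suc) (Pφ ∘ s≤s)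

weightVec : (s t : ℕ) → Vec Bool s
weightVec zero    t       = []
weightVec (suc s) zero    = false ∷ weightVec s zero
weightVec (suc s) (suc t) = true ∷ weightVec s t

count-weightVec : ∀ {s t} → t ℕ.≤ s → V.count T? (weightVec s t) ≡ t
count-weightVec {zero}  z≤n     = refl
count-weightVec {suc s} z≤n     = count-weightVec {s} z≤n
count-weightVec {suc s} (s≤s t≤s) = cong suc (count-weightVec t≤s)

values : ∀ {n m} → Vec (Affine n) m → Vec Bool n → List ℤ
values Ls x = toList (V.map (λ L → evalAffine L x) Ls)

-- kSTAT f unfolds to ∃[ c ] ∀ n → KStatRepresentation (f n) (poly c n).
KStatRepresentation : ∀ {n} → BoolFun n → ℕ → Set
KStatRepresentation {n} F B = ∃[ ℓ₁ ] ∃[ ℓ₂ ]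
  Σ (Vec (Affine n) ℓ₁) λ Ls → Σ (Vec (Affine n) ℓ₂) λ Rs → ∃[ kₗ ] ∃[ kᵣ ]
  (ℓ₁ ℕ.+ ℓ₂ ℕ.≤ B) × VAll.All (AffineBounded B) Ls × VAll.All (AffineBounded B) Rs ×
  (1 ℕ.≤ kₗ) × (kₗ ℕ.≤ ℓ₁) × (1 ℕ.≤ kᵣ) × (kᵣ ℕ.≤ ℓ₂) ×
  (∀ x → (F x ≡ true) ⇔ (kthSmallest kₗ (values Ls x) ℤ.< kthSmallest kᵣ (values Rs x)))

0<i≤+n⇒∣i∣≤n : ∀ {i n} → + 0 ℤ.< i → i ℤ.≤ + n → ∣ i ∣ ℕ.≤ n
0<i≤+n⇒∣i∣≤n (ℤ.+<+ _) (ℤ.+≤+ i≤n) = i≤n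

module SymMajCircuit {n s : ℕ} (hs : Vec (MajGate n) s) (g : Vec Bool s → Bool) where

  q : ℕ
  q = 3 ℕ.+ (s ℕ.+ s)

  lower upper : ℕ → ℤ
  lower j = + (2 ℕ.+ (j ℕ.+ j))
  upper j = if g (weightVec s (s ℕ.∸ j)) then + (3 ℕ.+ (j ℕ.+ j)) else + (1 ℕ.+ (j ℕ.+ j))

  lower-window : InOddWindow lower
  lower-window j = ℤ.+≤+ (ℕP.n≤1+n _) , ℤ.+≤+ (ℕP.n≤1+n _)

  upper-window : InOddWindow upper
  upper-window j with g (weightVec s (s ℕ.∸ j))
  ... | true  = ℤ.+≤+ (ℕP.m≤n+m _ 2) , ℤP.≤-refl
  ... | false = ℤP.≤-refl , ℤ.+≤+ (ℕP.m≤n+m _ 2)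

  lower<upper⇔ : ∀ j → (g (weightVec s (s ℕ.∸ j)) ≡ true) ⇔ (lower j ℤ.< upper j)
  lower<upper⇔ j with g (weightVec s (s ℕ.∸ j))
  ... | true  = mk⇔ (λ _ → ℤ.+<+ (ℕP.n<1+n _)) (λ _ → refl)
  ... | false = mk⇔ (λ ()) (λ lower<upper → contradiction (ℤ.+≤+ (ℕP.n≤1+n _)) (ℤP.<⇒≱ lower<upper))

  window-gap : ∀ {φ} → InOddWindow φ → ∀ {j} → j ℕ.≤ s → + 0 ℤ.< φ j × φ j ℤ.≤ + q
  window-gap window {j} j≤s =
    ℤP.<-≤-trans (ℤ.+<+ (s≤s z≤n)) (proj₁ (window j)) ,
    ℤP.≤-trans (proj₂ (window j)) (ℤ.+≤+ (ℕP.+-monoʳ-≤ 3 (ℕP.+-mono-≤ j≤s j≤s)))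

  forms : (ℕ → ℤ) → Vec (Affine n) (s ℕ.+ suc s)
  forms φ = V.map (gateᴬ q) hs V.++ V.map constᴬ (stairs (suc s) φ)

  values-forms : ∀ φ x → values (forms φ) x ≡ gateValues q hs x ++ toList (stairs (suc s) φ)
  values-forms φ x = begin
    toList (V.map ev (V.map (gateᴬ q) hs V.++ V.map constᴬ cs))
      ≡⟨ cong toList (VP.map-++ ev (V.map (gateᴬ q) hs) (V.map constᴬ cs)) ⟩
    toList (V.map ev (V.map (gateᴬ q) hs) V.++ V.map ev (V.map constᴬ cs))
      ≡⟨ VP.toList-++ (V.map ev (V.map (gateᴬ q) hs)) _ ⟩
    toList (V.map ev (V.map (gateᴬ q) hs)) ++ toList (V.map ev (V.map constᴬ cs))
      ≡⟨ cong₂ (λ us vs → toList us ++ toList vs) (sym (VP.map-∘ ev (gateᴬ q) hs)) constValues ⟩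
    gateValues q hs x ++ toList cs ∎
    where
    open ≡-Reasoning
    ev = λ (L : Affine n) → evalAffine L x
    cs = stairs (suc s) φ
    constValues : V.map ev (V.map constᴬ cs) ≡ cs
    constValues = trans (sym (VP.map-∘ ev constᴬ cs))
                        (trans (VP.map-cong (λ a → evalAffine-const a x) cs) (VP.map-id cs))

  kthSmallest-forms : ∀ φ → InOddWindow φ → ∀ x →
    kthSmallest (suc s) (values (forms φ) x) ≡ φ (s ℕ.∸ firing hs x)
  kthSmallest-forms φ window x = begin
    nth (sort (values (forms φ) x)) s         ≡⟨ cong (λ zs → nth (sort zs) s) (values-forms φ x) ⟩
    nth (sort zs) s                           ≡⟨ cong (nth (sort zs)) (ℕP.m+[n∸m]≡n t≤s) ⟨
    nth (sort zs) (t ℕ.+ (s ℕ.∸ t))           ≡⟨ nth-sort-gates++stairs q hs x (suc s) φ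
                                                   (oddWindow-monotone window) (s≤s j≤s) 0<φj φj≤q ⟩
    φ (s ℕ.∸ t)                               ∎
    where
    open ≡-Reasoning
    t = firing hs x
    t≤s = firing≤length hs x
    j≤s = ℕP.m∸n≤m s t
    zs = gateValues q hs x ++ toList (stairs (suc s) φ)
    0<φj = proj₁ (window-gap window j≤s)
    φj≤q = proj₂ (window-gap window j≤s)

  circuit : BoolFun n
  circuit x = g (V.map (λ h → evalMaj h x) hs)

  circuit-decided : Symmetric g → ∀ x →
    (circuit x ≡ true) ⇔
    (kthSmallest (suc s) (values (forms lower) x) ℤ.< kthSmallest (suc s) (values (forms upper) x))
  circuit-decided symmetric x =
    subst₂ (λ a b → (circuit x ≡ true) ⇔ (a ℤ.< b))
      (sym (kthSmallest-forms lower lower-window x)) (sym (kthSmallest-forms upper upper-window x))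
      (subst (λ c → (c ≡ true) ⇔ (lower (s ℕ.∸ t) ℤ.< upper (s ℕ.∸ t))) (sym circuit≡profile)
             (lower<upper⇔ (s ℕ.∸ t)))
    where
    t = firing hs x
    t≤s = firing≤length hs x
    circuit≡profile : circuit x ≡ g (weightVec s (s ℕ.∸ (s ℕ.∸ t)))
    circuit≡profile = trans (symmetric _ _ (sym (count-weightVec t≤s)))
                            (cong (g ∘ weightVec s) (sym (ℕP.m∸[m∸n]≡n t≤s)))

  module _ {B B′} (s≤B : s ℕ.≤ B) (fourth≤B′ : (4 ℕ.+ B) ℕ.^ 4 ℕ.≤ B′) where

    private
      Z = 4 ℕ.+ B
      4+2s≤Z² = 4+2s≤[4+P]² s≤B

      ≤B′ : ∀ {a b} → a ℕ.≤ (4 ℕ.+ (s ℕ.+ s)) ℕ.* b → b ℕ.≤ Z ℕ.* Z → a ℕ.≤ B′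
      ≤B′ a≤ b≤Z² = ℕP.≤-trans a≤ (ℕP.≤-trans (square≤fourth Z 4+2s≤Z² b≤Z²) fourth≤B′)

      k≤Z² : ∀ {k} → k ℕ.≤ 4 → k ℕ.≤ Z ℕ.* Z
      k≤Z² k≤4 = ℕP.≤-trans k≤4 (ℕP.≤-trans (ℕP.m≤m+n 4 (s ℕ.+ s)) 4+2s≤Z²)

    length-bounded : (s ℕ.+ suc s) ℕ.+ (s ℕ.+ suc s) ℕ.≤ B′
    length-bounded = ≤B′ (ℕP.≤-trans (ℕP.m≤m+n _ 6) (ℕP.≤-reflexive (expand s))) (k≤Z² (s≤s (s≤s z≤n)))
      where
      expand : ∀ s → (s ℕ.+ suc s) ℕ.+ (s ℕ.+ suc s) ℕ.+ 6 ≡ (4 ℕ.+ (s ℕ.+ s)) ℕ.* 2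
      expand = solve-∀ℕ

    forms-bounded : ∀ φ → InOddWindow φ → VAll.All (MajBounded B) hs →
      VAll.All (AffineBounded B′) (forms φ)
    forms-bounded φ window hs≤B =
      VAllP.++⁺ (VAllP.map⁺ (VAll.map (λ {h} → gate-bounded h) hs≤B))
                (VAllP.map⁺ (stairs⁺ (suc s) φ (λ {j} → const-bounded j)))
      where
      gate-bounded : ∀ h → MajBounded B h → AffineBounded B′ (gateᴬ q h)
      gate-bounded h h≤B =
        AffineBounded-mono (gateᴬ q h) (≤B′ ℕP.≤-refl (P²+P≤[4+P]² B)) (AffineBounded-gate q h h≤B)
      const-bounded : ∀ j → j ℕ.< suc s → AffineBounded B′ (constᴬ (φ j))
      const-bounded j (s≤s j≤s) = AffineBounded-mono (constᴬ (φ j))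
        (≤B′ (ℕP.≤-trans (0<i≤+n⇒∣i∣≤n 0<φj φj≤q) (ℕP.≤-trans (ℕP.n≤1+n q) (ℕP.m≤m*n _ 1)))
             (k≤Z² (s≤s z≤n)))
        (AffineBounded-const (φ j))
        where
        0<φj = proj₁ (window-gap window j≤s)
        φj≤q = proj₂ (window-gap window j≤s)

    representation : VAll.All (MajBounded B) hs → Symmetric g →
      ∀ {F : BoolFun n} → (∀ x → F x ≡ circuit x) → KStatRepresentation F B′
    representation hs≤B symmetric F≡circuit =
      s ℕ.+ suc s , s ℕ.+ suc s , forms lower , forms upper , suc s , suc s ,
      length-bounded ,
      forms-bounded lower lower-window hs≤B , forms-bounded upper upper-window hs≤B ,
      s≤s z≤n , ℕP.m≤n+m (suc s) s , s≤s z≤n , ℕP.m≤n+m (suc s) s ,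
      λ x → subst (λ b → (b ≡ true) ⇔ _) (sym (F≡circuit x)) (circuit-decided symmetric x)

theorem6 : (f : Family) → SYM∘MAJ f → kSTAT f
theorem6 f (c , circuits) = c′ , λ n →
  let (s , hs , g , s≤P , hs≤P , symmetric , computes) = circuits n
  in SymMajCircuit.representation hs g s≤P (fourth≤poly n) hs≤P symmetric computes
  where
  c′ = proj₁ (poly-power-bound 4 4 c)
  fourth≤poly = proj₂ (poly-power-bound 4 4 c)
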